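{- Let $R$ be a commutative ring. Let $(A,B,C,\lambda)$ and $(\tilde A,\tilde B,\tilde C,\tilde\lambda)$ be tuples with $A,B,\tilde A,\tilde B$ finite $R$-modules, $C,\tilde C$ finite cyclic groups, and $\lambda:A\times B\to C$, $\tilde\lambda:\tilde A\times\tilde B\to\tilde C$ $\mathbb{Z}$-bilinear, $R$-balanced and non-degenerate. Let $t_A:A\to\tilde A$ be an $R$-module isomorphism and $t_C:C\to\tilde C$ a group isomorphism. Then (1) there exists a unique group homomorphism $t_B:B\to\tilde B$ such that the map $\underline t=t_A\times t_B\times t_C:\mathcal{H}(A,B,C,\lambda)\to\mathcal{H}(\tilde A,\tilde B,\tilde C,\tilde\lambda)$, $h(a,b,c)\mapsto h(t_A(a),t_B(b),t_C(c))$, is a group homomorphism; and (2) this $t_B$ is an $R$-module isomorphism and $\underline t$ is an $R$-linear group isomorphism.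
   Context: $\mathcal{H}(A,B,C,\lambda)$ is the set $A\times B\times C$ with elements $h(a,b,c)$ and multiplication $h(a,b,c)h(a',b',c')=h(a+a',b+b',c+c'+\lambda(a,b'))$. $R$-balanced: $\lambda(ra,b)=\lambda(a,rb)$ for $r\in R$. Non-degenerate: left and right kernels of $\lambda$ are zero. A homomorphism $\theta$ between such groups mapping $h(0,0,C)$ into $h(0,0,\tilde C)$ is called $R$-linear if the induced map $A\oplus B\to\tilde A\oplus\tilde B$ is $R$-linear. -}

module Defs where

open import Level using (Level; _⊔_; suc)
open import Data.Nat using (ℕ)
import Data.Nat as ℕ
open import Data.Integer using (ℤ; +_; -[1+_])
open import Data.Fin using (Fin)
open import Data.Product using (Σ; ∃; _×_; _,_; proj₁; proj₂)
open import Relation.Binary.Bundles using (Setoid)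
import Relation.Binary.PropositionalEquality as ≡
open import Function.Bundles using (Inverse)
open import Algebra.Bundles using (CommutativeRing; AbelianGroup)
open import Algebra.Bundles.Raw using (RawGroup)
open import Algebra.Module.Bundles using (Module)
open import Algebra.Module.Construct.DirectProduct using (⟨module⟩)
open import Algebra.Module.Morphism.Structures using (module ModuleMorphisms)

private
  variable
    r ℓr a ℓa b ℓb c ℓc : Level

Finite : ∀ {s ℓ} → Setoid s ℓ → Set (s ⊔ ℓ)
Finite S = Σ ℕ λ n → Inverse S (≡.setoid (Fin n))

module _ (G : AbelianGroup c ℓc) where
  open AbelianGroup G

  ℕ-mul : ℕ → Carrier → Carrier
  ℕ-mul ℕ.zero    g = ε
  ℕ-mul (ℕ.suc n) g = g ∙ ℕ-mul n g

  ℤ-mul : ℤ → Carrier → Carrier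
  ℤ-mul (+ n)      g = ℕ-mul n g
  ℤ-mul -[1+ n ]   g = (ℕ-mul (ℕ.suc n) g) ⁻¹

  Cyclic : Set (c ⊔ ℓc)
  Cyclic = Σ Carrier λ g → ∀ x → Σ ℤ λ k → x ≈ ℤ-mul k g

record HData (R : CommutativeRing r ℓr) (a ℓa b ℓb c ℓc : Level)
       : Set (r ⊔ ℓr ⊔ suc (a ⊔ ℓa ⊔ b ⊔ ℓb ⊔ c ⊔ ℓc)) where
  open CommutativeRing R using () renaming (Carrier to Rc)
  field
    A : Module R a ℓa
    B : Module R b ℓb
    C : AbelianGroup c ℓc
  module A = Module A
  module B = Module B
  module C = AbelianGroup C
  field
    A-finite : Finite A.≈ᴹ-setoid
    B-finite : Finite B.≈ᴹ-setoid
    C-finite : Finite C.setoid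
    C-cyclic : Cyclic C
    λ′ : A.Carrierᴹ → B.Carrierᴹ → C.Carrier
    λ-cong : ∀ {x x′ y y′} → x A.≈ᴹ x′ → y B.≈ᴹ y′ → λ′ x y C.≈ λ′ x′ y′
    λ-addˡ : ∀ x x′ y → λ′ (x A.+ᴹ x′) y C.≈ (λ′ x y C.∙ λ′ x′ y)
    λ-addʳ : ∀ x y y′ → λ′ x (y B.+ᴹ y′) C.≈ (λ′ x y C.∙ λ′ x y′)
    λ-balanced : ∀ (s : Rc) x y → λ′ (s A.*ₗ x) y C.≈ λ′ x (s B.*ₗ y)
    λ-nondegˡ : ∀ x → (∀ y → λ′ x y C.≈ C.ε) → x A.≈ᴹ A.0ᴹ
    λ-nondegʳ : ∀ y → (∀ x → λ′ x y C.≈ C.ε) → y B.≈ᴹ B.0ᴹ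

module _ {R : CommutativeRing r ℓr} (D : HData R a ℓa b ℓb c ℓc) where
  open HData D

  HCarrier : Set (a ⊔ b ⊔ c)
  HCarrier = A.Carrierᴹ × B.Carrierᴹ × C.Carrier

  H-rawGroup : RawGroup (a ⊔ b ⊔ c) (ℓa ⊔ ℓb ⊔ ℓc)
  H-rawGroup = record
    { Carrier = HCarrier
    ; _≈_ = λ { (x , y , z) (x′ , y′ , z′) →
                x A.≈ᴹ x′ × y B.≈ᴹ y′ × z C.≈ z′ }
    ; _∙_ = λ { (x , y , z) (x′ , y′ , z′) →
                (x A.+ᴹ x′ , y B.+ᴹ y′ , (z C.∙ z′) C.∙ λ′ x y′) }
    ; ε = (A.0ᴹ , B.0ᴹ , C.ε)
    ; _⁻¹ = λ { (x , y , z) →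
                (A.-ᴹ x , B.-ᴹ y , (z C.⁻¹) C.∙ ((λ′ x (B.-ᴹ y)) C.⁻¹)) }
    }

  A⊕B : Module R (a ⊔ b) (ℓa ⊔ ℓb)
  A⊕B = ⟨module⟩ A B

-- R-linearity of a map θ : H(A,B,C,λ) → H(Ã,B̃,C̃,λ̃) mapping h(0,0,C) into
-- h(0,0,C̃): the induced map A ⊕ B → Ã ⊕ B̃, (a,b) ↦ (A,B)-part of θ(h(a,b,0)),
-- is R-linear.
module _ {R : CommutativeRing r ℓr} {a′ ℓa′ b′ ℓb′ c′ ℓc′ : Level}
         (D : HData R a ℓa b ℓb c ℓc) (D̃ : HData R a′ ℓa′ b′ ℓb′ c′ ℓc′) where
  private
    module D = HData D
    module D̃ = HData D̃

  induced : (HCarrier D → HCarrier D̃) → D.A.Carrierᴹ × D.B.Carrierᴹ →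
            D̃.A.Carrierᴹ × D̃.B.Carrierᴹ
  induced θ (x , y) = proj₁ (θ (x , y , D.C.ε)) , proj₁ (proj₂ (θ (x , y , D.C.ε)))

  MapsCenter : (HCarrier D → HCarrier D̃) → Set (c ⊔ ℓa′ ⊔ ℓb′)
  MapsCenter θ = ∀ z → proj₁ (θ (D.A.0ᴹ , D.B.0ᴹ , z)) D̃.A.≈ᴹ D̃.A.0ᴹ
                     × proj₁ (proj₂ (θ (D.A.0ᴹ , D.B.0ᴹ , z))) D̃.B.≈ᴹ D̃.B.0ᴹ

  IsRLinear : (HCarrier D → HCarrier D̃) → Set _
  IsRLinear θ = MapsCenter θ ×
    ModuleMorphisms.IsModuleHomomorphism
      (Module.rawModule (A⊕B D)) (Module.rawModule (A⊕B D̃)) (induced θ)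

  triple : (D.A.Carrierᴹ → D̃.A.Carrierᴹ) → (D.B.Carrierᴹ → D̃.B.Carrierᴹ) →
           (D.C.Carrier → D̃.C.Carrier) → HCarrier D → HCarrier D̃
  triple f g h (x , y , z) = (f x , g y , h z)

{-# OPTIONS --safe #-}
module Submission where

-- Non-degeneracy lets B̃ embed into Hom(A, C̃) (via λ̃ ∘ t_A) and A into Hom(B̃, C̃).
-- For a finite abelian group G and a finite cyclic group C, |Hom(G, C)| ≤ |G|: if a ∈ G
-- has order m, then φ(a) is one of the at most m elements of C killed by m, two
-- homomorphisms with the same value at a differ by a homomorphism G/⟨a⟩ → C, and
-- |G/⟨a⟩| = |G|/m. Counting therefore makes B̃ → Hom(A, C̃) onto, so x ↦ t_C(λ(x, y)) is
-- λ̃(t_A x, t_B y) for a unique t_B y. Non-degeneracy makes t_B additive and, with the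
-- symmetric count for λ, bijective; balancedness makes it R-linear. The identity
-- λ̃(t_A x, t_B y) = t_C(λ(x, y)) is precisely what makes t_A × t_B × t_C multiplicative.

open import Defs
open import Level using (Level; _⊔_)
open import Data.Nat as ℕ
  using (ℕ; zero; suc; _+_; _*_; _∸_; _≤_; _<_; z≤n; s≤s; _≤?_; _<?_; NonZero)
open import Data.Nat.Properties
  using ( ≤-trans; ≤-reflexive; ≤-pred; ≰⇒>; <⇒≤; ≤-<-trans; ≤∧≢⇒<; n≮n; n≢0⇒n>0
        ; m≤n⇒m<n∨m≡n; m∸n≤m; m<n⇒0<n∸m; m+[n∸m]≡n; +-suc; +-identityʳ; +-mono-≤; *-comm
        ; anyUpTo?)
open import Data.Nat.DivMod
  using (_%_; _/_; m%n<n; m≡m%n+[m/n]*n; m*n/n≡m; /-monoˡ-≤; m/n<m; m/n*n≤m)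
open import Data.Nat.Divisibility using (_∣_; divides; m%n≡0⇒n∣m)
open import Data.Nat.Induction using (<-wellFounded)
open import Data.Integer using (+_; -[1+_])
open import Data.Fin as Fin using (Fin)
open import Data.Fin.Properties using (pigeonhole; toℕ-fromℕ<; any?; all?; ¬∀⟶∃¬)
open import Data.List using (List; []; _∷_; _++_; length; lookup; filter; tabulate; applyUpTo; concatMap)
open import Data.List.Properties using (length-tabulate; length-applyUpTo; length-++)
open import Data.List.Membership.Propositional.Properties using (∈-lookup)
open import Data.List.Relation.Unary.All as All using (All; []; _∷_; reduce; universal-U)
import Data.List.Relation.Unary.All.Properties as All
open import Data.List.Relation.Unary.AllPairs using ([]; _∷_)
import Data.List.Relation.Unary.AllPairs.Properties as AllPairs
open import Data.List.Relation.Unary.Unique.Setoid using (Unique)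
import Data.List.Relation.Unary.Unique.Setoid.Properties as Unique
open import Data.Product as Product using (Σ; ∃; _×_; _,_; proj₁; proj₂)
open import Data.Sum using (inj₁; inj₂)
open import Data.Unit using (tt)
open import Function using (_∘_)
open import Function.Bundles using (Inverse)
open import Function.Definitions using (Surjective)
open import Induction.WellFounded using (Acc; acc)
open import Relation.Binary using (Rel; Setoid; Decidable)
import Relation.Binary.PropositionalEquality as ≡
open import Relation.Binary.PropositionalEquality using (_≡_)
open import Relation.Nullary using (¬_; yes; no; contradiction)
open import Relation.Nullary.Decidable using (_×-dec_)
import Relation.Unary as Unary
open import Relation.Unary using (Pred; U)
open import Relation.Unary.Properties using (∁?)
open import Algebra.Bundles using (CommutativeRing; AbelianGroup; Group)
open import Algebra.Bundles.Raw using (RawGroup)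
open import Algebra.Module.Bundles using (Module)
open import Algebra.Module.Construct.DirectProduct using (⟨module⟩)
open import Algebra.Morphism.Structures using (module MagmaMorphisms; module GroupMorphisms)
open import Algebra.Module.Morphism.Structures using (module ModuleMorphisms)
open MagmaMorphisms using (IsMagmaHomomorphism)
open GroupMorphisms using (IsGroupHomomorphism; IsGroupMonomorphism; IsGroupIsomorphism)
open ModuleMorphisms using (IsModuleHomomorphism; IsModuleIsomorphism)

private
  variable
    r ℓr a ℓa a′ ℓa′ b ℓb b′ ℓb′ c ℓc c′ ℓc′ g ℓg s ℓ s₁ ℓ₁ s₂ ℓ₂ : Level

-- Counting up to a setoid equality

-- Bounds on duplicate-free lists; unlike Finite, they pass to subsets and quotients.
module _ (S : Setoid s ℓ) where
  open Setoid S

  AtMost : ∀ {p} → Pred Carrier p → ℕ → Set (s ⊔ ℓ ⊔ p)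
  AtMost P n = ∀ xs → All P xs → Unique S xs → length xs ≤ n

  lookup-≉ : ∀ {xs} → Unique S xs → ∀ {i j} → i Fin.< j → lookup xs i ≉ lookup xs j
  lookup-≉ (x≉xs ∷ _)   {Fin.zero}  {Fin.suc j} _         = All.lookup x≉xs (∈-lookup j)
  lookup-≉ (_    ∷ xs!) {Fin.suc i} {Fin.suc j} (s≤s i<j) = lookup-≉ xs! i<j

  atMost⇒nonZero : ∀ {n} → Carrier → AtMost U n → NonZero n
  atMost⇒nonZero x bound = ℕ.>-nonZero (bound (x ∷ []) (universal-U _) ([] ∷ []))

  all-equal⇒atMost-1 : (∀ x y → x ≈ y) → AtMost U 1
  all-equal⇒atMost-1 all≈ []          _ _               = z≤n
  all-equal⇒atMost-1 all≈ (_ ∷ [])    _ _               = s≤s z≤n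
  all-equal⇒atMost-1 all≈ (x ∷ y ∷ _) _ ((x≉y ∷ _) ∷ _) = contradiction (all≈ x y) x≉y

atMost-Fin : ∀ n → AtMost (≡.setoid (Fin n)) U n
atMost-Fin n xs _ xs! with length xs ≤? n
... | yes ≤n = ≤n
... | no  ≰n with i , j , i<j , eq ← pigeonhole (≰⇒> ≰n) (lookup xs) =
  contradiction eq (lookup-≉ (≡.setoid _) xs! i<j)

module _ (S : Setoid s₁ ℓ₁) (T : Setoid s₂ ℓ₂)
         {p q} {P : Pred (Setoid.Carrier S) p} {Q : Pred (Setoid.Carrier T) q}
         (f : ∀ {x} → P x → Setoid.Carrier T)
         (f-injective : ∀ {x y} (px : P x) (py : P y) → Setoid._≈_ T (f px) (f py) → Setoid._≈_ S x y)
         (f-into : ∀ {x} (px : P x) → Q (f px)) where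
  private
    module S = Setoid S
    module T = Setoid T

    length-reduce : ∀ {xs} (pxs : All P xs) → length (reduce f pxs) ≡ length xs
    length-reduce []        = ≡.refl
    length-reduce (_ ∷ pxs) = ≡.cong suc (length-reduce pxs)

    reduce-into : ∀ {xs} (pxs : All P xs) → All Q (reduce f pxs)
    reduce-into []         = []
    reduce-into (px ∷ pxs) = f-into px ∷ reduce-into pxs

    reduce-≉ : ∀ {x xs} (px : P x) (pxs : All P xs) → All (x S.≉_) xs → All (f px T.≉_) (reduce f pxs)
    reduce-≉ px []         []           = []
    reduce-≉ px (py ∷ pxs) (x≉y ∷ x≉xs) = x≉y ∘ f-injective px py ∷ reduce-≉ px pxs x≉xs

    reduce-unique : ∀ {xs} (pxs : All P xs) → Unique S xs → Unique T (reduce f pxs)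
    reduce-unique []         []           = []
    reduce-unique (px ∷ pxs) (x≉xs ∷ xs!) = reduce-≉ px pxs x≉xs ∷ reduce-unique pxs xs!

  injective⇒atMost : ∀ {n} → AtMost T Q n → AtMost S P n
  injective⇒atMost bound xs pxs xs! = ≤-trans (≤-reflexive (≡.sym (length-reduce pxs)))
    (bound _ (reduce-into pxs) (reduce-unique pxs xs!))

module _ {S : Setoid s ℓ} (fin : Finite S) where
  open Setoid S
  open Inverse (proj₂ fin)

  to-injective : ∀ {x y} → to x ≡ to y → x ≈ y
  to-injective {x} {y} eq =
    trans (sym (strictlyInverseʳ x)) (trans (reflexive (≡.cong from eq)) (strictlyInverseʳ y))

  from-injective : ∀ {i j} → from i ≈ from j → i ≡ j
  from-injective {i} {j} eq =
    ≡.trans (≡.sym (strictlyInverseˡ i)) (≡.trans (to-cong eq) (strictlyInverseˡ j))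

  finite⇒decidable : Decidable _≈_
  finite⇒decidable x y with to x Fin.≟ to y
  ... | yes eq = yes (to-injective eq)
  ... | no  ne = no (ne ∘ to-cong)

  finite⇒atMost : AtMost S U (proj₁ fin)
  finite⇒atMost = injective⇒atMost S (≡.setoid (Fin _)) {P = U}
    (λ {x} _ → to x) (λ _ _ → to-injective) (λ _ → tt) (atMost-Fin _)

  enumeration-unique : Unique S (tabulate from)
  enumeration-unique = Unique.tabulate⁺ S from-injective

module _ {A : Set a} {p} {P : Pred A p} (P? : Unary.Decidable P) where

  length-filter-∁ : ∀ xs → length (filter P? xs) + length (filter (∁? P?) xs) ≡ length xs
  length-filter-∁ []       = ≡.refl
  length-filter-∁ (x ∷ xs) with P? x
  ... | yes _ = ≡.cong suc (length-filter-∁ xs)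
  ... | no  _ = ≡.trans (+-suc _ _) (≡.cong suc (length-filter-∁ xs))

module _ (S : Setoid s₁ ℓ₁) (T : Setoid s₂ ℓ₂)
         (_≟_ : Decidable (Setoid._≈_ T)) (key : Setoid.Carrier S → Setoid.Carrier T) where
  private
    module T = Setoid T
  open Data.Nat.Properties.≤-Reasoning

  fibres⇒atMost : ∀ {k} {K : Pred T.Carrier k} M {F} → AtMost T K M →
                  (∀ c → AtMost S (λ x → key x T.≈ c) F) → AtMost S (K ∘ key) (M * F)
  fibres⇒atMost zero    K≤0 _ []      _        _ = z≤n
  fibres⇒atMost zero    K≤0 _ (x ∷ _) (kx ∷ _) _ =
    contradiction (K≤0 (key x ∷ []) (kx ∷ []) ([] ∷ [])) λ ()
  fibres⇒atMost (suc M) _   _ []      _        _ = z≤n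
  fibres⇒atMost {K = K} (suc M) {F} K≤1+M fibre≤F xs@(x ∷ _) kxs@(kx ∷ _) xs! = begin
    length xs                                             ≡⟨ length-filter-∁ at? xs ⟨
    length (filter at? xs) + length (filter (∁? at?) xs)  ≤⟨ +-mono-≤ fibre rest ⟩
    F + M * F                                             ∎
    where
    at? : Unary.Decidable (λ y → key y T.≈ key x)
    at? y = key y ≟ key x
    K′ : Pred T.Carrier _
    K′ c = K c × c T.≉ key x
    K′≤M : AtMost T K′ M
    K′≤M ks kks ks! = ≤-pred (K≤1+M (key x ∷ ks) (kx ∷ All.map proj₁ kks)
                                     (All.map (λ k′ e → proj₂ k′ (T.sym e)) kks ∷ ks!))
    fibre : length (filter at? xs) ≤ F
    fibre = fibre≤F (key x) _ (All.all-filter at? xs) (Unique.filter⁺ S at? xs!)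
    rest : length (filter (∁? at?) xs) ≤ M * F
    rest = fibres⇒atMost M K′≤M fibre≤F _
             (All.zip (All.filter⁺ (∁? at?) kxs , All.all-filter (∁? at?) xs))
             (Unique.filter⁺ S (∁? at?) xs!)

-- Multiples and orders in abelian groups

module _ {p} {P : ℕ → Set p} where

  Least : ℕ → Set p
  Least m = P m × (∀ {j} → j < m → ¬ P j)

module _ {p} {P : ℕ → Set p} (P? : Unary.Decidable P) where
  private
    least-from : ∀ n k → (∀ {j} → j < k → ¬ P j) → P (n + k) → ∃ (Least {P = P})
    least-from n k below pn+k with P? k
    ... | yes pk = k , pk , below
    least-from zero    k below pk   | no ¬pk = contradiction pk ¬pk
    least-from (suc n) k below pn+k | no ¬pk =
      least-from n (suc k) below′ (≡.subst P (≡.sym (+-suc n k)) pn+k)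
      where
      below′ : ∀ {j} → j < suc k → ¬ P j
      below′ j<1+k with m≤n⇒m<n∨m≡n (≤-pred j<1+k)
      ... | inj₁ j<k    = below j<k
      ... | inj₂ ≡.refl = ¬pk

  least : ∀ {n} → P n → ∃ (Least {P = P})
  least {n} pn = least-from n 0 (λ ()) (≡.subst P (≡.sym (+-identityʳ n)) pn)

module _ (G : Group g ℓg) (H : Group c ℓc) {f : Group.Carrier G → Group.Carrier H}
         (f-homo : IsMagmaHomomorphism (Group.rawMagma G) (Group.rawMagma H) f) where
  private
    module G = Group G
    module H = Group H
  open IsMagmaHomomorphism f-homo
  open import Algebra.Properties.Group H using (identityʳ-unique; inverseˡ-unique)
  open import Relation.Binary.Reasoning.Setoid H.setoid

  magma⇒ε-homo : f G.ε H.≈ H.ε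
  magma⇒ε-homo = identityʳ-unique (f G.ε) (f G.ε) (begin
    f G.ε H.∙ f G.ε  ≈⟨ homo G.ε G.ε ⟨
    f (G.ε G.∙ G.ε)  ≈⟨ ⟦⟧-cong (G.identityˡ G.ε) ⟩
    f G.ε            ∎)

  magma⇒⁻¹-homo : ∀ x → f (x G.⁻¹) H.≈ f x H.⁻¹
  magma⇒⁻¹-homo x = inverseˡ-unique (f (x G.⁻¹)) (f x) (begin
    f (x G.⁻¹) H.∙ f x  ≈⟨ homo (x G.⁻¹) x ⟨
    f (x G.⁻¹ G.∙ x)    ≈⟨ ⟦⟧-cong (G.inverseˡ x) ⟩
    f G.ε               ≈⟨ magma⇒ε-homo ⟩
    H.ε                 ∎)

  magma⇒isGroupHomomorphism : IsGroupHomomorphism G.rawGroup H.rawGroup f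
  magma⇒isGroupHomomorphism = record
    { isMonoidHomomorphism = record { isMagmaHomomorphism = f-homo ; ε-homo = magma⇒ε-homo }
    ; ⁻¹-homo              = magma⇒⁻¹-homo
    }

module Multiples (G : AbelianGroup g ℓ) where
  open AbelianGroup G
  open import Algebra.Properties.AbelianGroup G using (identityʳ-unique; inverseʳ-unique)
  open import Algebra.Properties.Monoid.Mult monoid public
    using ()
    renaming ( _×_ to _·_; ×-congʳ to ·-congʳ; ×-homo-1 to ·-homo-1; ×-homo-+ to ·-homo-+
             ; ×-assocˡ to ·-assocˡ)
  open import Relation.Binary.Reasoning.Setoid setoid

  ℕ-mul≈· : ∀ n x → ℕ-mul G n x ≈ n · x
  ℕ-mul≈· zero    x = refl
  ℕ-mul≈· (suc n) x = ∙-congˡ (ℕ-mul≈· n x)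

  ·-zeroʳ : ∀ n → n · ε ≈ ε
  ·-zeroʳ zero    = refl
  ·-zeroʳ (suc n) = trans (identityˡ _) (·-zeroʳ n)

  ·-comm : ∀ m n x → m · (n · x) ≈ n · (m · x)
  ·-comm m n x = begin
    m · (n · x)  ≈⟨ ·-assocˡ x m n ⟩
    (m * n) · x  ≡⟨ ≡.cong (_· x) (*-comm m n) ⟩
    (n * m) · x  ≈⟨ ·-assocˡ x n m ⟨
    n · (m · x)  ∎

  ·-cancel : ∀ {i j x} → i ≤ j → i · x ≈ j · x → (j ∸ i) · x ≈ ε
  ·-cancel {i} {j} {x} i≤j eq = identityʳ-unique (i · x) ((j ∸ i) · x) (begin
    i · x ∙ (j ∸ i) · x  ≈⟨ ·-homo-+ x i (j ∸ i) ⟨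
    (i + (j ∸ i)) · x    ≡⟨ ≡.cong (_· x) (m+[n∸m]≡n i≤j) ⟩
    j · x                ≈⟨ eq ⟨
    i · x                ∎)

  ·-mod : ∀ {m x} .{{_ : NonZero m}} → m · x ≈ ε → ∀ j → j · x ≈ (j % m) · x
  ·-mod {m} {x} mx≈ε j = begin
    j · x                          ≡⟨ ≡.cong (_· x) (m≡m%n+[m/n]*n j m) ⟩
    (j % m + j / m * m) · x        ≈⟨ ·-homo-+ x (j % m) (j / m * m) ⟩
    (j % m) · x ∙ (j / m * m) · x  ≈⟨ ∙-congˡ (·-assocˡ x (j / m) m) ⟨
    (j % m) · x ∙ (j / m) · m · x  ≈⟨ ∙-congˡ (trans (·-congʳ (j / m) mx≈ε) (·-zeroʳ (j / m))) ⟩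
    (j % m) · x ∙ ε                ≈⟨ identityʳ _ ⟩
    (j % m) · x                    ∎

  ·-inverse : ∀ {m x} .{{_ : NonZero m}} → m · x ≈ ε → ∀ j → (j · x) ⁻¹ ≈ (ℕ.pred m * j) · x
  ·-inverse {suc m} {x} 1+m·x≈ε j = sym (inverseʳ-unique (j · x) ((m * j) · x) (begin
    j · x ∙ (m * j) · x  ≈⟨ ·-homo-+ x j (m * j) ⟨
    (suc m * j) · x      ≡⟨ ≡.cong (_· x) (*-comm (suc m) j) ⟩
    (j * suc m) · x      ≈⟨ ·-assocˡ x j (suc m) ⟨
    j · suc m · x        ≈⟨ ·-congʳ j 1+m·x≈ε ⟩
    j · ε                ≈⟨ ·-zeroʳ j ⟩
    ε                    ∎))

  SmallTorsion : Set (g ⊔ ℓ)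
  SmallTorsion = ∀ m .{{_ : NonZero m}} → AtMost setoid (λ x → m · x ≈ ε) m

  record IsOrder (x : Carrier) (m : ℕ) : Set ℓ where
    field
      {{nonZero}} : NonZero m
      annihilates : m · x ≈ ε
      minimal     : ∀ {j} → 0 < j → j < m → j · x ≉ ε

  module _ {x m} (o : IsOrder x m) where
    open IsOrder o

    order-distinct : ∀ {i j} → i < j → j < m → i · x ≉ j · x
    order-distinct {i} {j} i<j j<m eq =
      minimal (m<n⇒0<n∸m i<j) (≤-<-trans (m∸n≤m j i) j<m) (·-cancel (<⇒≤ i<j) eq)

    order>1 : x ≉ ε → 1 < m
    order>1 x≉ε = ≤∧≢⇒< (ℕ.>-nonZero⁻¹ m) λ { ≡.refl → x≉ε (trans (sym (·-homo-1 x)) annihilates) }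

    order-∣ : ∀ k → k · x ≈ ε → m ∣ k
    order-∣ k kx≈ε = m%n≡0⇒n∣m k m k%m≡0
      where
      k%m≡0 : k % m ≡ 0
      k%m≡0 with k % m ℕ.≟ 0
      ... | yes k%m≡0 = k%m≡0
      ... | no  k%m≢0 = contradiction (trans (sym (·-mod annihilates k)) kx≈ε)
                                      (minimal (n≢0⇒n>0 k%m≢0) (m%n<n k m))

  module _ (_≟_ : Decidable _≈_) {n} (bound : AtMost setoid U n) where
    private
      Annihilates : Carrier → ℕ → Set ℓ
      Annihilates x j = 0 < j × j · x ≈ ε

      annihilates? : ∀ x → Unary.Decidable (Annihilates x)
      annihilates? x j = (0 <? j) ×-dec ((j · x) ≟ ε)

    order-exists : ∀ x → ∃ (IsOrder x)
    order-exists x with anyUpTo? (annihilates? x) (suc n)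
    ... | yes (_ , _ , annihilates-j) =
      let m , (0<m , mx≈ε) , below = least (annihilates? x) annihilates-j
      in m , record { nonZero     = ℕ.>-nonZero 0<m
                    ; annihilates = mx≈ε
                    ; minimal     = λ 0<j j<m jx≈ε → below j<m (0<j , jx≈ε) }
    ... | no none = contradiction (bound _ (universal-U _) multiples-unique) (n≮n n ∘ 1+n≤)
      where
      multiples-unique : Unique setoid (applyUpTo (_· x) (suc n))
      multiples-unique = Unique.applyUpTo⁺₁ setoid (_· x) (suc n) λ {i} {j} i<j j<1+n eq →
        none (j ∸ i , ≤-<-trans (m∸n≤m j i) j<1+n , m<n⇒0<n∸m i<j , ·-cancel (<⇒≤ i<j) eq)
      1+n≤ : length (applyUpTo (_· x) (suc n)) ≤ n → suc n ≤ n
      1+n≤ = ≤-trans (≤-reflexive (≡.sym (length-applyUpTo (_· x) (suc n))))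

    cyclic⇒·-generated : Cyclic G → Σ Carrier λ g → ∀ x → ∃ λ k → x ≈ k · g
    cyclic⇒·-generated (g , gen) with e , o ← order-exists g = g , λ x → ·-multiple (gen x)
      where
      open IsOrder o
      ·-multiple : ∀ {x} → ∃ (λ k → x ≈ ℤ-mul G k g) → ∃ λ k → x ≈ k · g
      ·-multiple (+ k      , x≈kg) = k , trans x≈kg (ℕ-mul≈· k g)
      ·-multiple {x} (-[1+ k ] , x≈kg) = ℕ.pred e * suc k , (begin
        x                       ≈⟨ x≈kg ⟩
        ℕ-mul G (suc k) g ⁻¹    ≈⟨ ⁻¹-cong (ℕ-mul≈· (suc k) g) ⟩
        (suc k · g) ⁻¹          ≈⟨ ·-inverse annihilates (suc k) ⟩
        (ℕ.pred e * suc k) · g  ∎)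

    -- The m-torsion of ⟨g⟩ is generated by k₀ · g, where k₀ is the order of m · g.
    ·-generated⇒smallTorsion : ∀ g → (∀ x → ∃ λ k → x ≈ k · g) → SmallTorsion
    ·-generated⇒smallTorsion g gen m with k₀ , o ← order-exists (m · g) =
      injective⇒atMost setoid (≡.setoid (Fin m)) index index-injective (λ _ → tt) (atMost-Fin m)
      where
      h : Carrier
      h = k₀ · g

      torsion⇒multiple : ∀ {x} → m · x ≈ ε → ∃ λ q → x ≈ q · h
      torsion⇒multiple {x} mx≈ε with k , x≈kg ← gen x
        with divides q k≡q*k₀ ← order-∣ o k (trans (·-comm k m g) (trans (·-congʳ m (sym x≈kg)) mx≈ε)) =
        q , (begin
          x             ≈⟨ x≈kg ⟩
          k · g         ≡⟨ ≡.cong (_· g) k≡q*k₀ ⟩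
          (q * k₀) · g  ≈⟨ ·-assocˡ g q k₀ ⟨
          q · h         ∎)

      index : ∀ {x} → m · x ≈ ε → Fin m
      index mx≈ε = Fin.fromℕ< (m%n<n (proj₁ (torsion⇒multiple mx≈ε)) m)

      index-sound : ∀ {x} (mx≈ε : m · x ≈ ε) → x ≈ Fin.toℕ (index mx≈ε) · h
      index-sound {x} mx≈ε = begin
        x                                     ≈⟨ proj₂ (torsion⇒multiple mx≈ε) ⟩
        q · h                                 ≈⟨ ·-mod (trans (·-comm m k₀ g) (IsOrder.annihilates o)) q ⟩
        (q % m) · h                           ≡⟨ ≡.cong (_· h) (toℕ-fromℕ< (m%n<n q m)) ⟨
        Fin.toℕ (Fin.fromℕ< (m%n<n q m)) · h  ∎
        where
        q : ℕ
        q = proj₁ (torsion⇒multiple mx≈ε)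

      index-injective : ∀ {x y} (mx≈ε : m · x ≈ ε) (my≈ε : m · y ≈ ε) →
                        index mx≈ε ≡ index my≈ε → x ≈ y
      index-injective mx≈ε my≈ε eq = trans (index-sound mx≈ε)
        (trans (reflexive (≡.cong (λ i → Fin.toℕ i · h) eq)) (sym (index-sound my≈ε)))

-- Homomorphisms and quotients of abelian groups

module _ (G : AbelianGroup g ℓg) (C : AbelianGroup c ℓc) where
  private
    module G = AbelianGroup G
    module C = AbelianGroup C
    module MG = Multiples G
    module MC = Multiples C

  record Hom : Set (g ⊔ ℓg ⊔ c ⊔ ℓc) where
    field
      ⟦_⟧                 : G.Carrier → C.Carrier
      isMagmaHomomorphism : IsMagmaHomomorphism G.rawMagma C.rawMagma ⟦_⟧

    open IsMagmaHomomorphism isMagmaHomomorphism public using (⟦⟧-cong; homo)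

    isGroupHomomorphism : IsGroupHomomorphism G.rawGroup C.rawGroup ⟦_⟧
    isGroupHomomorphism = magma⇒isGroupHomomorphism G.group C.group isMagmaHomomorphism

    open IsGroupHomomorphism isGroupHomomorphism public using (ε-homo; ⁻¹-homo)

    ·-homo : ∀ n x → ⟦ n MG.· x ⟧ C.≈ n MC.· ⟦ x ⟧
    ·-homo zero    x = ε-homo
    ·-homo (suc n) x = C.trans (homo x (n MG.· x)) (C.∙-congˡ (·-homo n x))

  open Hom

  Hom-setoid : Setoid (g ⊔ ℓg ⊔ c ⊔ ℓc) (g ⊔ ℓc)
  Hom-setoid = record
    { Carrier       = Hom
    ; _≈_           = λ φ ψ → ∀ x → ⟦ φ ⟧ x C.≈ ⟦ ψ ⟧ x
    ; isEquivalence = record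
      { refl  = λ _ → C.refl
      ; sym   = λ φ≈ψ x → C.sym (φ≈ψ x)
      ; trans = λ φ≈ψ ψ≈χ x → C.trans (φ≈ψ x) (ψ≈χ x)
      }
    }

  trivial⇒homs-equal : (∀ x → x G.≈ G.ε) → ∀ φ ψ → Setoid._≈_ Hom-setoid φ ψ
  trivial⇒homs-equal trivial φ ψ x = C.trans (vanishes φ) (C.sym (vanishes ψ))
    where
    vanishes : ∀ χ → ⟦ χ ⟧ x C.≈ C.ε
    vanishes χ = C.trans (⟦⟧-cong χ (trivial x)) (ε-homo χ)

module _ {G : AbelianGroup g ℓg} {C : AbelianGroup c ℓc} where
  private
    module G = AbelianGroup G
    module C = AbelianGroup C
  open Hom
  open import Algebra.Properties.AbelianGroup C using (⁻¹-∙-comm)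
  open import Algebra.Properties.CommutativeSemigroup C.commutativeSemigroup using (interchange)
  open import Relation.Binary.Reasoning.Setoid C.setoid

  infixl 6 _-ₕ_
  _-ₕ_ : Hom G C → Hom G C → Hom G C
  φ -ₕ ψ = record
    { ⟦_⟧                 = λ x → ⟦ φ ⟧ x C.- ⟦ ψ ⟧ x
    ; isMagmaHomomorphism = record
      { isRelHomomorphism = record
        { cong = λ x≈y → C.∙-cong (⟦⟧-cong φ x≈y) (C.⁻¹-cong (⟦⟧-cong ψ x≈y)) }
      ; homo = λ x y → begin
          ⟦ φ ⟧ (x G.∙ y) C.- ⟦ ψ ⟧ (x G.∙ y)
            ≈⟨ C.∙-cong (homo φ x y) (C.⁻¹-cong (homo ψ x y)) ⟩
          (⟦ φ ⟧ x C.∙ ⟦ φ ⟧ y) C.∙ (⟦ ψ ⟧ x C.∙ ⟦ ψ ⟧ y) C.⁻¹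
            ≈⟨ C.∙-congˡ (⁻¹-∙-comm (⟦ ψ ⟧ x) (⟦ ψ ⟧ y)) ⟨
          (⟦ φ ⟧ x C.∙ ⟦ φ ⟧ y) C.∙ (⟦ ψ ⟧ x C.⁻¹ C.∙ ⟦ ψ ⟧ y C.⁻¹)
            ≈⟨ interchange _ _ _ _ ⟩
          (⟦ φ ⟧ x C.- ⟦ ψ ⟧ x) C.∙ (⟦ φ ⟧ y C.- ⟦ ψ ⟧ y)  ∎
      }
    }

-- G / ⟨a⟩ is modelled as G with the coarser equality x ~ y ⇔ x ∈ y + ⟨a⟩.
module Quotient (G : AbelianGroup g ℓ) {a m} (o : Multiples.IsOrder G a m) where
  open AbelianGroup G
  open Multiples G
  open IsOrder o
  open import Algebra.Properties.AbelianGroup G using (⁻¹-∙-comm; ∙-cancelˡ)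
  open import Algebra.Properties.CommutativeSemigroup commutativeSemigroup using (interchange)
  open import Relation.Binary.Reasoning.Setoid setoid

  infix 4 _~_
  _~_ : Rel Carrier ℓ
  x ~ y = ∃ λ j → x ≈ y ∙ j · a

  ≈⇒~ : ∀ {x y} → x ≈ y → x ~ y
  ≈⇒~ {x} {y} x≈y = 0 , trans x≈y (sym (identityʳ y))

  ~-sym : ∀ {x y} → x ~ y → y ~ x
  ~-sym {x} {y} (j , x≈) = ℕ.pred m * j , (begin
    y                          ≈⟨ identityʳ y ⟨
    y ∙ ε                      ≈⟨ ∙-congˡ (inverseʳ (j · a)) ⟨
    y ∙ (j · a ∙ (j · a) ⁻¹)   ≈⟨ assoc y (j · a) _ ⟨
    y ∙ j · a ∙ (j · a) ⁻¹     ≈⟨ ∙-cong x≈ (sym (·-inverse annihilates j)) ⟨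
    x ∙ (ℕ.pred m * j) · a     ∎)

  ~-trans : ∀ {x y z} → x ~ y → y ~ z → x ~ z
  ~-trans {x} {y} {z} (j , x≈) (k , y≈) = k + j , (begin
    x                    ≈⟨ x≈ ⟩
    y ∙ j · a            ≈⟨ ∙-congʳ y≈ ⟩
    z ∙ k · a ∙ j · a    ≈⟨ assoc z _ _ ⟩
    z ∙ (k · a ∙ j · a)  ≈⟨ ∙-congˡ (·-homo-+ a k j) ⟨
    z ∙ (k + j) · a      ∎)

  ~-∙-cong : ∀ {x x′ y y′} → x ~ x′ → y ~ y′ → x ∙ y ~ x′ ∙ y′
  ~-∙-cong {x} {x′} {y} {y′} (j , x≈) (k , y≈) = j + k , (begin
    x ∙ y                        ≈⟨ ∙-cong x≈ y≈ ⟩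
    (x′ ∙ j · a) ∙ (y′ ∙ k · a)  ≈⟨ interchange x′ _ y′ _ ⟩
    (x′ ∙ y′) ∙ (j · a ∙ k · a)  ≈⟨ ∙-congˡ (·-homo-+ a j k) ⟨
    x′ ∙ y′ ∙ (j + k) · a        ∎)

  ~-⁻¹-cong : ∀ {x x′} → x ~ x′ → x ⁻¹ ~ x′ ⁻¹
  ~-⁻¹-cong {x} {x′} (j , x≈) = ℕ.pred m * j , (begin
    x ⁻¹                        ≈⟨ ⁻¹-cong x≈ ⟩
    (x′ ∙ j · a) ⁻¹             ≈⟨ ⁻¹-∙-comm x′ (j · a) ⟨
    x′ ⁻¹ ∙ (j · a) ⁻¹          ≈⟨ ∙-congˡ (·-inverse annihilates j) ⟩
    x′ ⁻¹ ∙ (ℕ.pred m * j) · a  ∎)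

  quotient : AbelianGroup g ℓ
  quotient = record
    { Carrier = Carrier ; _≈_ = _~_ ; _∙_ = _∙_ ; ε = ε ; _⁻¹ = _⁻¹
    ; isAbelianGroup = record
      { isGroup = record
        { isMonoid = record
          { isSemigroup = record
            { isMagma = record
              { isEquivalence = record { refl = ≈⇒~ refl ; sym = ~-sym ; trans = ~-trans }
              ; ∙-cong        = ~-∙-cong
              }
            ; assoc = λ x y z → ≈⇒~ (assoc x y z)
            }
          ; identity = (λ x → ≈⇒~ (identityˡ x)) , (λ x → ≈⇒~ (identityʳ x))
          }
        ; inverse = (λ x → ≈⇒~ (inverseˡ x)) , (λ x → ≈⇒~ (inverseʳ x))
        ; ⁻¹-cong = ~-⁻¹-cong
        }
      ; comm = λ x y → ≈⇒~ (comm x y)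
      }
    }

  ~-decidable : Decidable _≈_ → Decidable _~_
  ~-decidable _≟_ x y with any? {n = m} (λ j → x ≟ (y ∙ Fin.toℕ j · a))
  ... | yes (j , x≈) = yes (Fin.toℕ j , x≈)
  ... | no  x≁y      = no λ (j , x≈) → x≁y (Fin.fromℕ< (m%n<n j m) , (begin
    x                                         ≈⟨ x≈ ⟩
    y ∙ j · a                                 ≈⟨ ∙-congˡ (·-mod annihilates j) ⟩
    y ∙ (j % m) · a                           ≡⟨ ≡.cong (λ k → y ∙ k · a) (toℕ-fromℕ< (m%n<n j m)) ⟨
    y ∙ Fin.toℕ (Fin.fromℕ< (m%n<n j m)) · a  ∎))

  coset : Carrier → List Carrier
  coset y = applyUpTo (λ j → y ∙ j · a) m

  coset-~ : ∀ y → All (_~ y) (coset y)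
  coset-~ y = All.applyUpTo⁺₁ _ m λ {j} _ → j , refl

  coset-unique : ∀ y → Unique setoid (coset y)
  coset-unique y = Unique.applyUpTo⁺₁ setoid _ m λ i<j j<m eq →
    order-distinct o i<j j<m (∙-cancelˡ y _ _ eq)

  cosets : List Carrier → List Carrier
  cosets = concatMap coset

  length-cosets : ∀ ys → length (cosets ys) ≡ length ys * m
  length-cosets []       = ≡.refl
  length-cosets (y ∷ ys) = ≡.trans (length-++ (coset y))
    (≡.cong₂ _+_ (length-applyUpTo _ m) (length-cosets ys))

  cosets-avoid : ∀ {v y} ys → v ~ y → All (λ y′ → ¬ y ~ y′) ys → All (v ≉_) (cosets ys)
  cosets-avoid []        _   []            = []
  cosets-avoid (y′ ∷ ys) v~y (y≁y′ ∷ y≁ys) = All.++⁺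
    (All.map (λ w~y′ v≈w → y≁y′ (~-trans (~-sym v~y) (~-trans (≈⇒~ v≈w) w~y′))) (coset-~ y′))
    (cosets-avoid ys v~y y≁ys)

  cosets-unique : ∀ {ys} → Unique (AbelianGroup.setoid quotient) ys → Unique setoid (cosets ys)
  cosets-unique {[]}     []           = []
  cosets-unique {y ∷ ys} (y≁ys ∷ ys!) = AllPairs.++⁺ (coset-unique y) (cosets-unique ys!)
    (All.map (λ v~y → cosets-avoid ys v~y y≁ys) (coset-~ y))

  quotient-atMost : ∀ {n} → AtMost setoid U n → AtMost (AbelianGroup.setoid quotient) U (n / m)
  quotient-atMost {n} bound ys _ ys! =
    ≤-trans (≤-reflexive (≡.sym (m*n/n≡m (length ys) m))) (/-monoˡ-≤ m cosets≤n)
    where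
    cosets≤n : length ys * m ≤ n
    cosets≤n = ≤-trans (≤-reflexive (≡.sym (length-cosets ys)))
                       (bound (cosets ys) (universal-U _) (cosets-unique ys!))

module _ {G : AbelianGroup g ℓ} {C : AbelianGroup c ℓc} {a m} (o : Multiples.IsOrder G a m) where
  private
    module C = AbelianGroup C
    module MC = Multiples C
  open AbelianGroup G using (_∙_)
  open Multiples G using (_·_)
  open Quotient G o using (quotient; _~_)
  open Hom
  open import Relation.Binary.Reasoning.Setoid C.setoid

  descend : (φ : Hom G C) → ⟦ φ ⟧ a C.≈ C.ε → Hom quotient C
  descend φ φa≈ε = record
    { ⟦_⟧                 = ⟦ φ ⟧
    ; isMagmaHomomorphism = record
      { isRelHomomorphism = record { cong = φ-cong }
      ; homo              = homo φ
      }
    }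
    where
    φ-cong : ∀ {x y} → x ~ y → ⟦ φ ⟧ x C.≈ ⟦ φ ⟧ y
    φ-cong {x} {y} (j , x≈) = begin
      ⟦ φ ⟧ x                     ≈⟨ ⟦⟧-cong φ x≈ ⟩
      ⟦ φ ⟧ (y ∙ j · a)           ≈⟨ homo φ y (j · a) ⟩
      ⟦ φ ⟧ y C.∙ ⟦ φ ⟧ (j · a)   ≈⟨ C.∙-congˡ (·-homo φ j a) ⟩
      ⟦ φ ⟧ y C.∙ j MC.· ⟦ φ ⟧ a  ≈⟨ C.∙-congˡ (C.trans (MC.·-congʳ j φa≈ε) (MC.·-zeroʳ j)) ⟩
      ⟦ φ ⟧ y C.∙ C.ε             ≈⟨ C.identityʳ _ ⟩
      ⟦ φ ⟧ y                     ∎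

-- Counting homomorphisms into a group with small torsion

module _ (C : AbelianGroup c ℓc) (_≟_ : Decidable (AbelianGroup._≈_ C))
         (C-smallTorsion : Multiples.SmallTorsion C) where
  private
    module C = AbelianGroup C
    module MC = Multiples C
  open Hom
  open import Algebra.Properties.AbelianGroup C using (x≈y⇒x∙y⁻¹≈ε; ∙-cancelʳ)

  -- φ(a) is killed by m, and homomorphisms agreeing at a differ by one that descends to G / ⟨a⟩.
  hom-atMost-quotient : ∀ {G : AbelianGroup g ℓg} {a m} (o : Multiples.IsOrder G a m) {k} →
                        AtMost (Hom-setoid (Quotient.quotient G o) C) U k →
                        AtMost (Hom-setoid G C) U (m * k)
  hom-atMost-quotient {G = G} {a} {m} o {k} quotient-homs hs _ hs! =
    fibres⇒atMost (Hom-setoid G C) C.setoid _≟_ key m (C-smallTorsion m) fibre-atMost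
      hs (All.universal key-torsion hs) hs!
    where
    open Multiples.IsOrder o
    open Quotient G o using (quotient)

    key : Hom G C → C.Carrier
    key φ = ⟦ φ ⟧ a

    key-torsion : ∀ φ → m MC.· key φ C.≈ C.ε
    key-torsion φ = C.trans (C.sym (·-homo φ m a)) (C.trans (⟦⟧-cong φ annihilates) (ε-homo φ))

    fibre-atMost : ∀ c → AtMost (Hom-setoid G C) (λ φ → key φ C.≈ c) k
    fibre-atMost c []        _                _   = z≤n
    fibre-atMost c (φ₀ ∷ φs) pφs@(φ₀a≈c ∷ _) φs! =
      injective⇒atMost (Hom-setoid G C) (Hom-setoid quotient C) {P = λ φ → key φ C.≈ c} {Q = U}
        (λ {ψ} → shift {ψ}) (λ {ψ} {χ} → shift-injective {ψ} {χ}) (λ _ → tt) quotient-homs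
        (φ₀ ∷ φs) pφs φs!
      where
      shift : ∀ {ψ} → key ψ C.≈ c → Hom quotient C
      shift {ψ} ψa≈c = descend o (ψ -ₕ φ₀) (x≈y⇒x∙y⁻¹≈ε (C.trans ψa≈c (C.sym φ₀a≈c)))

      shift-injective : ∀ {ψ χ} (ψa≈c : key ψ C.≈ c) (χa≈c : key χ C.≈ c) →
                        (∀ x → ⟦ shift {ψ} ψa≈c ⟧ x C.≈ ⟦ shift {χ} χa≈c ⟧ x) →
                        ∀ x → ⟦ ψ ⟧ x C.≈ ⟦ χ ⟧ x
      shift-injective _ _ eq x = ∙-cancelʳ (⟦ φ₀ ⟧ x C.⁻¹) _ _ (eq x)

  hom-atMost : (G : AbelianGroup g ℓg) → Decidable (AbelianGroup._≈_ G) →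
               ∀ {N} (e : Fin N → AbelianGroup.Carrier G) → (∀ x → ∃ λ i → AbelianGroup._≈_ G x (e i)) →
               ∀ {n} → Acc _<_ n → AtMost (AbelianGroup.setoid G) U n → AtMost (Hom-setoid G C) U n
  hom-atMost G _≟ᴳ_ e e-onto {n} (acc smaller) bound hs _ hs!
    with all? (λ i → e i ≟ᴳ AbelianGroup.ε G)
  ... | yes trivial =
    ≤-trans (all-equal⇒atMost-1 (Hom-setoid G C) (trivial⇒homs-equal G C G-trivial) hs (universal-U hs) hs!)
            (ℕ.>-nonZero⁻¹ n {{atMost⇒nonZero G.setoid G.ε bound}})
    where
    module G = AbelianGroup G
    G-trivial : ∀ x → x G.≈ G.ε
    G-trivial x = G.trans (proj₂ (e-onto x)) (trivial _)
  ... | no nontrivial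
    with i , eᵢ≉ε ← ¬∀⟶∃¬ _ _ (λ i → e i ≟ᴳ AbelianGroup.ε G) nontrivial
    with m , o ← Multiples.order-exists G _≟ᴳ_ bound (e i) =
    ≤-trans (hom-atMost-quotient o quotient-homs hs (universal-U hs) hs!)
            (≤-trans (≤-reflexive (*-comm m (n / m))) (m/n*n≤m n m))
    where
    module G = AbelianGroup G
    open Multiples.IsOrder o
    open Quotient G o using (quotient; ≈⇒~; ~-decidable; quotient-atMost)

    instance
      n-nonZero : NonZero n
      n-nonZero = atMost⇒nonZero G.setoid G.ε bound

    quotient-homs : AtMost (Hom-setoid quotient C) U (n / m)
    quotient-homs = hom-atMost quotient (~-decidable _≟ᴳ_) e
      (λ x → proj₁ (e-onto x) , ≈⇒~ (proj₂ (e-onto x)))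
      (smaller (m/n<m n m (Multiples.order>1 G o eᵢ≉ε))) (quotient-atMost bound)

  hom-atMost-finite : (G : AbelianGroup g ℓg) (fin : Finite (AbelianGroup.setoid G)) →
                      AtMost (Hom-setoid G C) U (proj₁ fin)
  hom-atMost-finite G fin = hom-atMost G (finite⇒decidable fin) from
    (λ x → to x , AbelianGroup.sym G (strictlyInverseʳ x)) (<-wellFounded _) (finite⇒atMost fin)
    where open Inverse (proj₂ fin)

-- Pairings

record Pairing (A : AbelianGroup a ℓa) (B : AbelianGroup b ℓb) (C : AbelianGroup c ℓc)
               : Set (a ⊔ ℓa ⊔ b ⊔ ℓb ⊔ c ⊔ ℓc) where
  private
    module A = AbelianGroup A
    module B = AbelianGroup B
    module C = AbelianGroup C
  field
    ⟨_,_⟩          : A.Carrier → B.Carrier → C.Carrier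
    ⟨⟩-cong        : ∀ {x x′ y y′} → x A.≈ x′ → y B.≈ y′ → ⟨ x , y ⟩ C.≈ ⟨ x′ , y′ ⟩
    ⟨⟩-homoˡ       : ∀ x x′ y → ⟨ x A.∙ x′ , y ⟩ C.≈ ⟨ x , y ⟩ C.∙ ⟨ x′ , y ⟩
    ⟨⟩-homoʳ       : ∀ x y y′ → ⟨ x , y B.∙ y′ ⟩ C.≈ ⟨ x , y ⟩ C.∙ ⟨ x , y′ ⟩
    nondegenerateˡ : ∀ x → (∀ y → ⟨ x , y ⟩ C.≈ C.ε) → x A.≈ A.ε
    nondegenerateʳ : ∀ y → (∀ x → ⟨ x , y ⟩ C.≈ C.ε) → y B.≈ B.ε

  ⟨-,_⟩ : B.Carrier → Hom A C
  ⟨-, y ⟩ = record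
    { ⟦_⟧                 = ⟨_, y ⟩
    ; isMagmaHomomorphism = record
      { isRelHomomorphism = record { cong = λ x≈x′ → ⟨⟩-cong x≈x′ B.refl }
      ; homo              = λ x x′ → ⟨⟩-homoˡ x x′ y
      }
    }

  ⟨_,-⟩ : A.Carrier → Hom B C
  ⟨ x ,-⟩ = record
    { ⟦_⟧                 = ⟨ x ,_⟩
    ; isMagmaHomomorphism = record
      { isRelHomomorphism = record { cong = ⟨⟩-cong A.refl }
      ; homo              = ⟨⟩-homoʳ x
      }
    }

  ⟨-,⟩-injective : ∀ {y y′} → (∀ x → ⟨ x , y ⟩ C.≈ ⟨ x , y′ ⟩) → y B.≈ y′
  ⟨-,⟩-injective {y} {y′} eq = x∙y⁻¹≈ε⇒x≈y y y′ (nondegenerateʳ (y B.- y′) λ x → begin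
    ⟨ x , y B.- y′ ⟩                ≈⟨ ⟨⟩-homoʳ x y (y′ B.⁻¹) ⟩
    ⟨ x , y ⟩ C.∙ ⟨ x , y′ B.⁻¹ ⟩    ≈⟨ C.∙-congˡ (Hom.⁻¹-homo ⟨ x ,-⟩ y′) ⟩
    ⟨ x , y ⟩ C.- ⟨ x , y′ ⟩        ≈⟨ x≈y⇒x∙y⁻¹≈ε (eq x) ⟩
    C.ε                             ∎)
    where
    open import Algebra.Properties.AbelianGroup B using (x∙y⁻¹≈ε⇒x≈y)
    open import Algebra.Properties.AbelianGroup C using (x≈y⇒x∙y⁻¹≈ε)
    open import Relation.Binary.Reasoning.Setoid C.setoid

  -- Together with ⟨-,⟩-injective: y ↦ ⟨-, y ⟩ is a bijection B ≅ Hom(A, C).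
  Perfect : Set (a ⊔ ℓa ⊔ b ⊔ c ⊔ ℓc)
  Perfect = ∀ (φ : Hom A C) → ∃ λ y → ∀ x → ⟨ x , y ⟩ C.≈ Hom.⟦ φ ⟧ x

module _ {A : AbelianGroup a ℓa} {B : AbelianGroup b ℓb} {C : AbelianGroup c ℓc} where

  flip : Pairing A B C → Pairing B A C
  flip μ = record
    { ⟨_,_⟩          = λ y x → ⟨ x , y ⟩
    ; ⟨⟩-cong        = λ y≈y′ x≈x′ → ⟨⟩-cong x≈x′ y≈y′
    ; ⟨⟩-homoˡ       = λ y y′ x → ⟨⟩-homoʳ x y y′
    ; ⟨⟩-homoʳ       = λ y x x′ → ⟨⟩-homoˡ x x′ y
    ; nondegenerateˡ = nondegenerateʳ
    ; nondegenerateʳ = nondegenerateˡ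
    }
    where open Pairing μ

  module _ (_≟_ : Decidable (AbelianGroup._≈_ C)) (C-smallTorsion : Multiples.SmallTorsion C)
           (A-finite : Finite (AbelianGroup.setoid A)) (B-finite : Finite (AbelianGroup.setoid B))
           (μ : Pairing A B C) where
    private
      module A = AbelianGroup A
      module B = AbelianGroup B
      module C = AbelianGroup C
      module EA = Inverse (proj₂ A-finite)
      module EB = Inverse (proj₂ B-finite)
      |A| |B| : ℕ
      |A| = proj₁ A-finite
      |B| = proj₁ B-finite
    open Pairing μ
    open Hom

    |A|≤|B| : |A| ≤ |B|
    |A|≤|B| = ≤-trans (≤-reflexive (≡.sym (length-tabulate EA.from)))
      (injective⇒atMost A.setoid (Hom-setoid B C) {P = U} {Q = U}
        (λ {x} _ → ⟨ x ,-⟩) (λ _ _ → Pairing.⟨-,⟩-injective (flip μ)) (λ _ → tt)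
        (hom-atMost-finite C _≟_ C-smallTorsion B B-finite)
        (tabulate EA.from) (universal-U _) (enumeration-unique A-finite))

    finite⇒perfect : Perfect
    finite⇒perfect φ with any? (λ j → all? λ i → ⟨ EA.from i , EB.from j ⟩ ≟ ⟦ φ ⟧ (EA.from i))
    ... | yes (j , agrees) = EB.from j , λ x → C.trans
          (⟨⟩-cong (A.sym (EA.strictlyInverseʳ x)) B.refl)
          (C.trans (agrees (EA.to x)) (⟦⟧-cong φ (EA.strictlyInverseʳ x)))
    -- Otherwise φ and the ⟨-, y ⟩ are |B| + 1 distinct homomorphisms, but |Hom(A, C)| ≤ |A| ≤ |B|.
    ... | no  disagrees = contradiction (≤-trans |B|<|A| |A|≤|B|) (n≮n |B|)
      where
      candidates : List (Hom A C)
      candidates = φ ∷ tabulate (λ j → ⟨-, EB.from j ⟩)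
      candidates-unique : Unique (Hom-setoid A C) candidates
      candidates-unique =
        All.tabulate⁺ (λ j φ≈ → disagrees (j , λ i → C.sym (φ≈ (EA.from i))))
        ∷ Unique.tabulate⁺ (Hom-setoid A C) (from-injective B-finite ∘ ⟨-,⟩-injective)
      |B|<|A| : suc |B| ≤ |A|
      |B|<|A| = ≤-trans (≤-reflexive (≡.cong suc (≡.sym (length-tabulate (λ j → ⟨-, EB.from j ⟩)))))
        (hom-atMost-finite C _≟_ C-smallTorsion A A-finite candidates (universal-U _) candidates-unique)

module _ {A′ : AbelianGroup a′ ℓa′} {A : AbelianGroup a ℓa}
         {B : AbelianGroup b ℓb} {C : AbelianGroup c ℓc} where
  private
    module A = AbelianGroup A
    module B = AbelianGroup B
    module C = AbelianGroup C

  precompose : (f : AbelianGroup.Carrier A′ → A.Carrier) →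
               IsGroupIsomorphism (AbelianGroup.rawGroup A′) A.rawGroup f →
               Pairing A B C → Pairing A′ B C
  precompose f f-iso μ = record
    { ⟨_,_⟩          = λ x y → ⟨ f x , y ⟩
    ; ⟨⟩-cong        = λ x≈x′ → ⟨⟩-cong (⟦⟧-cong x≈x′)
    ; ⟨⟩-homoˡ       = λ x x′ y → C.trans (⟨⟩-cong (∙-homo x x′) B.refl) (⟨⟩-homoˡ (f x) (f x′) y)
    ; ⟨⟩-homoʳ       = λ x → ⟨⟩-homoʳ (f x)
    ; nondegenerateˡ = λ x fx⊥ → injective (A.trans (nondegenerateˡ (f x) fx⊥) (A.sym ε-homo))
    ; nondegenerateʳ = λ y ⊥y → nondegenerateʳ y λ x →
        let x′ , fx′≈x = surjective x in
        C.trans (⟨⟩-cong (A.sym (fx′≈x (AbelianGroup.refl A′))) B.refl) (⊥y x′)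
    }
    where
    open Pairing μ
    open IsGroupIsomorphism f-iso

module _ {A : AbelianGroup a ℓa} {B : AbelianGroup b ℓb}
         {C : AbelianGroup c ℓc} {C′ : AbelianGroup c′ ℓc′} where
  private
    module C′ = AbelianGroup C′

  postcompose : (f : AbelianGroup.Carrier C → C′.Carrier) →
                IsGroupMonomorphism (AbelianGroup.rawGroup C) C′.rawGroup f →
                Pairing A B C → Pairing A B C′
  postcompose f f-mono μ = record
    { ⟨_,_⟩          = λ x y → f ⟨ x , y ⟩
    ; ⟨⟩-cong        = λ x≈x′ y≈y′ → ⟦⟧-cong (⟨⟩-cong x≈x′ y≈y′)
    ; ⟨⟩-homoˡ       = λ x x′ y → C′.trans (⟦⟧-cong (⟨⟩-homoˡ x x′ y)) (∙-homo _ _)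
    ; ⟨⟩-homoʳ       = λ x y y′ → C′.trans (⟦⟧-cong (⟨⟩-homoʳ x y y′)) (∙-homo _ _)
    ; nondegenerateˡ = λ x x⊥ → nondegenerateˡ x λ y → injective (C′.trans (x⊥ y) (C′.sym ε-homo))
    ; nondegenerateʳ = λ y ⊥y → nondegenerateʳ y λ x → injective (C′.trans (⊥y x) (C′.sym ε-homo))
    }
    where
    open Pairing μ
    open IsGroupMonomorphism f-mono

module Transport {A : AbelianGroup a ℓa} {B : AbelianGroup b ℓb}
                 {B′ : AbelianGroup b′ ℓb′} {C : AbelianGroup c ℓc}
                 (μ : Pairing A B C) (ν : Pairing A B′ C) (ν-perfect : Pairing.Perfect ν) where
  private
    module A  = AbelianGroup A
    module B  = AbelianGroup B
    module B′ = AbelianGroup B′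
    module C  = AbelianGroup C
    module μ  = Pairing μ
    module ν  = Pairing ν
  open import Relation.Binary.Reasoning.Setoid C.setoid

  t : B.Carrier → B′.Carrier
  t y = proj₁ (ν-perfect μ.⟨-, y ⟩)

  t-spec : ∀ y x → ν.⟨ x , t y ⟩ C.≈ μ.⟨ x , y ⟩
  t-spec y = proj₂ (ν-perfect μ.⟨-, y ⟩)

  t-unique : ∀ {y y′} → (∀ x → ν.⟨ x , y′ ⟩ C.≈ μ.⟨ x , y ⟩) → y′ B′.≈ t y
  t-unique {y} eq = ν.⟨-,⟩-injective λ x → C.trans (eq x) (C.sym (t-spec y x))

  t-cong : ∀ {y y′} → y B.≈ y′ → t y B′.≈ t y′
  t-cong {y} y≈y′ = t-unique λ x → C.trans (t-spec y x) (μ.⟨⟩-cong A.refl y≈y′)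

  t-homo : ∀ y y′ → t (y B.∙ y′) B′.≈ t y B′.∙ t y′
  t-homo y y′ = B′.sym (t-unique λ x → begin
    ν.⟨ x , t y B′.∙ t y′ ⟩              ≈⟨ ν.⟨⟩-homoʳ x (t y) (t y′) ⟩
    ν.⟨ x , t y ⟩ C.∙ ν.⟨ x , t y′ ⟩    ≈⟨ C.∙-cong (t-spec y x) (t-spec y′ x) ⟩
    μ.⟨ x , y ⟩ C.∙ μ.⟨ x , y′ ⟩        ≈⟨ μ.⟨⟩-homoʳ x y y′ ⟨
    μ.⟨ x , y B.∙ y′ ⟩                  ∎)

  t-isGroupHomomorphism : IsGroupHomomorphism B.rawGroup B′.rawGroup t
  t-isGroupHomomorphism = magma⇒isGroupHomomorphism B.group B′.group record
    { isRelHomomorphism = record { cong = t-cong }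
    ; homo              = t-homo
    }

  t-injective : ∀ {y y′} → t y B′.≈ t y′ → y B.≈ y′
  t-injective {y} {y′} ty≈ty′ = μ.⟨-,⟩-injective λ x → begin
    μ.⟨ x , y ⟩     ≈⟨ t-spec y x ⟨
    ν.⟨ x , t y ⟩   ≈⟨ ν.⟨⟩-cong A.refl ty≈ty′ ⟩
    ν.⟨ x , t y′ ⟩  ≈⟨ t-spec y′ x ⟩
    μ.⟨ x , y′ ⟩    ∎

  t-surjective : Pairing.Perfect μ → Surjective B._≈_ B′._≈_ t
  t-surjective μ-perfect = strictlySurjective⇒surjective t-cong λ y′ →
    let y , μ≈ν = μ-perfect ν.⟨-, y′ ⟩ in y , B′.sym (t-unique λ x → C.sym (μ≈ν x))
    where open import Function.Consequences.Setoid B.setoid B′.setoid using (strictlySurjective⇒surjective)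

-- The Heisenberg groups H(A, B, C, λ)

module _ {R : CommutativeRing r ℓr} {M : Module R a ℓa} {M′ : Module R a′ ℓa′}
         {N : Module R b ℓb} {N′ : Module R b′ ℓb′} where
  private
    module M′ = Module M′
    module N′ = Module N′

  map-isModuleHomomorphism :
    ∀ {f g} → IsModuleHomomorphism (Module.rawModule M) (Module.rawModule M′) f →
              IsModuleHomomorphism (Module.rawModule N) (Module.rawModule N′) g →
    IsModuleHomomorphism (Module.rawModule (⟨module⟩ M N)) (Module.rawModule (⟨module⟩ M′ N′))
                         (Product.map f g)
  map-isModuleHomomorphism f-hom g-hom = record
    { isBimoduleHomomorphism = record
      { +ᴹ-isGroupHomomorphism = record
        { isMonoidHomomorphism = record
          { isMagmaHomomorphism = record
            { isRelHomomorphism = record { cong = Product.map F.⟦⟧-cong G.⟦⟧-cong }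
            ; homo              = λ (x , y) (x′ , y′) → F.+ᴹ-homo x x′ , G.+ᴹ-homo y y′
            }
          ; ε-homo = F.0ᴹ-homo , G.0ᴹ-homo
          }
        ; ⁻¹-homo = λ (x , y) → F.-ᴹ-homo x , G.-ᴹ-homo y
        }
      ; *ₗ-homo = λ s (x , y) → F.*ₗ-homo s x , G.*ₗ-homo s y
      ; *ᵣ-homo = λ s (x , y) → F.*ᵣ-homo s x , G.*ᵣ-homo s y
      }
    }
    where
    module F = IsModuleHomomorphism f-hom
    module G = IsModuleHomomorphism g-hom

module _ {R : CommutativeRing r ℓr} (D : HData R a ℓa b ℓb c ℓc) where
  open HData D

  pairing : Pairing A.+ᴹ-abelianGroup B.+ᴹ-abelianGroup C
  pairing = record
    { ⟨_,_⟩          = λ′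
    ; ⟨⟩-cong        = λ-cong
    ; ⟨⟩-homoˡ       = λ-addˡ
    ; ⟨⟩-homoʳ       = λ-addʳ
    ; nondegenerateˡ = λ-nondegˡ
    ; nondegenerateʳ = λ-nondegʳ
    }

  C-decidable : Decidable C._≈_
  C-decidable = finite⇒decidable C-finite

  C-smallTorsion : Multiples.SmallTorsion C
  C-smallTorsion = Multiples.·-generated⇒smallTorsion C C-decidable (finite⇒atMost C-finite) generator generates
    where
    open Σ (Multiples.cyclic⇒·-generated C C-decidable (finite⇒atMost C-finite) C-cyclic)
      renaming (proj₁ to generator; proj₂ to generates)

module Isomorphism {R : CommutativeRing r ℓr}
  (D : HData R a ℓa b ℓb c ℓc) (D̃ : HData R a′ ℓa′ b′ ℓb′ c′ ℓc′)
  (tA : Module.Carrierᴹ (HData.A D) → Module.Carrierᴹ (HData.A D̃))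
  (tA-iso : IsModuleIsomorphism (Module.rawModule (HData.A D)) (Module.rawModule (HData.A D̃)) tA)
  (tC : AbelianGroup.Carrier (HData.C D) → AbelianGroup.Carrier (HData.C D̃))
  (tC-iso : IsGroupIsomorphism (AbelianGroup.rawGroup (HData.C D)) (AbelianGroup.rawGroup (HData.C D̃)) tC)
  where
  private
    module D = HData D
    module D̃ = HData D̃
    module TA = IsModuleIsomorphism tA-iso
    module TC = IsGroupIsomorphism tC-iso
    module B̃ = AbelianGroup D̃.B.+ᴹ-abelianGroup
    module C̃ = AbelianGroup D̃.C

  μ : Pairing D.A.+ᴹ-abelianGroup D.B.+ᴹ-abelianGroup D̃.C
  μ = postcompose tC TC.isGroupMonomorphism (pairing D)

  ν : Pairing D.A.+ᴹ-abelianGroup D̃.B.+ᴹ-abelianGroup D̃.C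
  ν = precompose tA TA.+ᴹ-isGroupIsomorphism (pairing D̃)

  perfect : ∀ {b ℓb} {B : AbelianGroup b ℓb} → Finite (AbelianGroup.setoid B) →
            (π : Pairing D.A.+ᴹ-abelianGroup B D̃.C) → Pairing.Perfect π
  perfect B-finite = finite⇒perfect (C-decidable D̃) (C-smallTorsion D̃) D.A-finite B-finite

  open Transport μ ν (perfect D̃.B-finite ν) public renaming (t to tB)

  tB-*ₗ : ∀ s y → tB (s D.B.*ₗ y) B̃.≈ s D̃.B.*ₗ tB y
  tB-*ₗ s y = B̃.sym (t-unique λ x → begin
    D̃.λ′ (tA x) (s D̃.B.*ₗ tB y)    ≈⟨ D̃.λ-balanced s (tA x) (tB y) ⟨
    D̃.λ′ (s D̃.A.*ₗ tA x) (tB y)    ≈⟨ D̃.λ-cong (TA.*ₗ-homo s x) B̃.refl ⟨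
    D̃.λ′ (tA (s D.A.*ₗ x)) (tB y)  ≈⟨ t-spec y (s D.A.*ₗ x) ⟩
    tC (D.λ′ (s D.A.*ₗ x) y)       ≈⟨ TC.⟦⟧-cong (D.λ-balanced s x y) ⟩
    tC (D.λ′ x (s D.B.*ₗ y))       ∎)
    where open import Relation.Binary.Reasoning.Setoid C̃.setoid

  tB-*ᵣ : ∀ s y → tB (y D.B.*ᵣ s) B̃.≈ tB y D̃.B.*ᵣ s
  tB-*ᵣ s y = B̃.trans (t-cong (D.B.≈ᴹ-sym (D.B.*ₗ-*ᵣ-coincident s y)))
                       (B̃.trans (tB-*ₗ s y) (D̃.B.*ₗ-*ᵣ-coincident s (tB y)))

  tB-isModuleIsomorphism : IsModuleIsomorphism D.B.rawModule D̃.B.rawModule tB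
  tB-isModuleIsomorphism = record
    { isModuleMonomorphism = record
      { isModuleHomomorphism = record
        { isBimoduleHomomorphism = record
          { +ᴹ-isGroupHomomorphism = t-isGroupHomomorphism
          ; *ₗ-homo                = tB-*ₗ
          ; *ᵣ-homo                = tB-*ᵣ
          }
        }
      ; injective = t-injective
      }
    ; surjective = t-surjective (perfect D.B-finite μ)
    }

  θ : HCarrier D → HCarrier D̃
  θ = triple D D̃ tA tB tC

  private
    module H  = RawGroup (H-rawGroup D)
    module H̃ = RawGroup (H-rawGroup D̃)
    module tB = IsGroupHomomorphism t-isGroupHomomorphism
  open import Relation.Binary.Reasoning.Setoid C̃.setoid

  θ-homo : ∀ u v → θ (u H.∙ v) H̃.≈ θ u H̃.∙ θ v
  θ-homo (x , y , z) (x′ , y′ , z′) = TA.+ᴹ-homo x x′ , tB.homo y y′ , (begin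
    tC ((z D.C.∙ z′) D.C.∙ D.λ′ x y′)      ≈⟨ TC.∙-homo _ _ ⟩
    tC (z D.C.∙ z′) C̃.∙ tC (D.λ′ x y′)     ≈⟨ C̃.∙-cong (TC.∙-homo z z′) (C̃.sym (t-spec y′ x)) ⟩
    (tC z C̃.∙ tC z′) C̃.∙ D̃.λ′ (tA x) (tB y′)  ∎)

  θ-⁻¹-homo : ∀ u → θ (u H.⁻¹) H̃.≈ θ u H̃.⁻¹
  θ-⁻¹-homo (x , y , z) = TA.-ᴹ-homo x , tB.⁻¹-homo y , (begin
    tC (z D.C.⁻¹ D.C.∙ D.λ′ x (D.B.-ᴹ y) D.C.⁻¹)
      ≈⟨ TC.∙-homo _ _ ⟩
    tC (z D.C.⁻¹) C̃.∙ tC (D.λ′ x (D.B.-ᴹ y) D.C.⁻¹)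
      ≈⟨ C̃.∙-cong (TC.⁻¹-homo z) (TC.⁻¹-homo _) ⟩
    tC z C̃.⁻¹ C̃.∙ tC (D.λ′ x (D.B.-ᴹ y)) C̃.⁻¹
      ≈⟨ C̃.∙-congˡ (C̃.⁻¹-cong (t-spec (D.B.-ᴹ y) x)) ⟨
    tC z C̃.⁻¹ C̃.∙ D̃.λ′ (tA x) (tB (D.B.-ᴹ y)) C̃.⁻¹
      ≈⟨ C̃.∙-congˡ (C̃.⁻¹-cong (D̃.λ-cong D̃.A.≈ᴹ-refl (tB.⁻¹-homo y))) ⟩
    tC z C̃.⁻¹ C̃.∙ D̃.λ′ (tA x) (D̃.B.-ᴹ tB y) C̃.⁻¹
      ∎)

  θ-isGroupHomomorphism : IsGroupHomomorphism (H-rawGroup D) (H-rawGroup D̃) θ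
  θ-isGroupHomomorphism = record
    { isMonoidHomomorphism = record
      { isMagmaHomomorphism = record
        { isRelHomomorphism = record
          { cong = λ (x≈ , y≈ , z≈) → TA.⟦⟧-cong x≈ , t-cong y≈ , TC.⟦⟧-cong z≈ }
        ; homo              = θ-homo
        }
      ; ε-homo = TA.0ᴹ-homo , tB.ε-homo , TC.ε-homo
      }
    ; ⁻¹-homo = θ-⁻¹-homo
    }

  θ-isGroupIsomorphism : IsGroupIsomorphism (H-rawGroup D) (H-rawGroup D̃) θ
  θ-isGroupIsomorphism = record
    { isGroupMonomorphism = record
      { isGroupHomomorphism = θ-isGroupHomomorphism
      ; injective = λ (x≈ , y≈ , z≈) → TA.injective x≈ , t-injective y≈ , TC.injective z≈
      }
    ; surjective = λ (x̃ , ỹ , z̃) →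
        let x , tAx≈ = TA.surjective x̃
            y , tBy≈ = t-surjective (perfect D.B-finite μ) ỹ
            z , tCz≈ = TC.surjective z̃
        in (x , y , z) , λ (x≈ , y≈ , z≈) → tAx≈ x≈ , tBy≈ y≈ , tCz≈ z≈
    }

  θ-mapsCenter : MapsCenter D D̃ θ
  θ-mapsCenter _ = TA.0ᴹ-homo , tB.ε-homo

  induced-θ-isModuleHomomorphism :
    IsModuleHomomorphism (Module.rawModule (A⊕B D)) (Module.rawModule (A⊕B D̃)) (induced D D̃ θ)
  induced-θ-isModuleHomomorphism =
    map-isModuleHomomorphism {M = D.A} {D̃.A} {D.B} {D̃.B} {tA} {tB} TA.isModuleHomomorphism
    (IsModuleIsomorphism.isModuleHomomorphism tB-isModuleIsomorphism)

  θ-isRLinear : IsRLinear D D̃ θ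
  θ-isRLinear = θ-mapsCenter , induced-θ-isModuleHomomorphism

  -- Compare the C̃-components of θ′ (h(x, 0, 0) h(0, y, 0)) = θ′ (h(x, 0, 0)) θ′ (h(0, y, 0)).
  tB-unique : ∀ tB′ → IsGroupHomomorphism (H-rawGroup D) (H-rawGroup D̃) (triple D D̃ tA tB′ tC) →
              ∀ y → tB′ y B̃.≈ tB y
  tB-unique tB′ θ′-hom y = t-unique λ x → begin
    D̃.λ′ (tA x) (tB′ y)                              ≈⟨ C̃.identityˡ _ ⟨
    C̃.ε C̃.∙ D̃.λ′ (tA x) (tB′ y)                      ≈⟨ C̃.∙-congʳ tCε∙tCε≈ε ⟨
    (tC D.C.ε C̃.∙ tC D.C.ε) C̃.∙ D̃.λ′ (tA x) (tB′ y)  ≈⟨ central-component x ⟨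
    tC ((D.C.ε D.C.∙ D.C.ε) D.C.∙ D.λ′ x y)           ≈⟨ TC.⟦⟧-cong (εε∙λ≈λ x) ⟩
    tC (D.λ′ x y)                                    ∎
    where
    central-component : ∀ x → tC ((D.C.ε D.C.∙ D.C.ε) D.C.∙ D.λ′ x y)
                                C̃.≈ (tC D.C.ε C̃.∙ tC D.C.ε) C̃.∙ D̃.λ′ (tA x) (tB′ y)
    central-component x =
      proj₂ (proj₂ (IsGroupHomomorphism.homo θ′-hom (x , D.B.0ᴹ , D.C.ε) (D.A.0ᴹ , y , D.C.ε)))

    tCε∙tCε≈ε : tC D.C.ε C̃.∙ tC D.C.ε C̃.≈ C̃.ε
    tCε∙tCε≈ε = C̃.trans (C̃.∙-cong TC.ε-homo TC.ε-homo) (C̃.identityˡ C̃.ε)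

    εε∙λ≈λ : ∀ x → (D.C.ε D.C.∙ D.C.ε) D.C.∙ D.λ′ x y D.C.≈ D.λ′ x y
    εε∙λ≈λ x = D.C.trans (D.C.∙-congʳ (D.C.identityˡ _)) (D.C.identityˡ _)

theorem5p8 : ∀ {r ℓr a ℓa b ℓb c ℓc a′ ℓa′ b′ ℓb′ c′ ℓc′ : Level}
  (R : CommutativeRing r ℓr)
  (D : HData R a ℓa b ℓb c ℓc) (D̃ : HData R a′ ℓa′ b′ ℓb′ c′ ℓc′) →
  let A = HData.A D
      B = HData.B D
      C = HData.C D
      Ã = HData.A D̃
      B̃ = HData.B D̃
      C̃ = HData.C D̃
      IsGroupHomB = GroupMorphisms.IsGroupHomomorphism (Module.+ᴹ-rawGroup B) (Module.+ᴹ-rawGroup B̃)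
      IsGroupHomH = GroupMorphisms.IsGroupHomomorphism (H-rawGroup D) (H-rawGroup D̃)
      IsGroupIsoH = GroupMorphisms.IsGroupIsomorphism (H-rawGroup D) (H-rawGroup D̃)
  in (tA : Module.Carrierᴹ A → Module.Carrierᴹ Ã) →
  ModuleMorphisms.IsModuleIsomorphism (Module.rawModule A) (Module.rawModule Ã) tA →
  (tC : AbelianGroup.Carrier C → AbelianGroup.Carrier C̃) →
  GroupMorphisms.IsGroupIsomorphism (AbelianGroup.rawGroup C) (AbelianGroup.rawGroup C̃) tC →
  Σ (Module.Carrierᴹ B → Module.Carrierᴹ B̃) λ tB →
    -- (1) existence: t_B is a group homomorphism and t = t_A × t_B × t_C is one
    (IsGroupHomB tB × IsGroupHomH (triple D D̃ tA tB tC))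
    -- (1) uniqueness
    × (∀ (tB′ : Module.Carrierᴹ B → Module.Carrierᴹ B̃) →
         IsGroupHomB tB′ → IsGroupHomH (triple D D̃ tA tB′ tC) →
         ∀ y → Module._≈ᴹ_ B̃ (tB′ y) (tB y))
    -- (2) t_B is an R-module isomorphism, t an R-linear group isomorphism
    × ModuleMorphisms.IsModuleIsomorphism (Module.rawModule B) (Module.rawModule B̃) tB
    × IsGroupIsoH (triple D D̃ tA tB tC)
    × IsRLinear D D̃ (triple D D̃ tA tB tC)
theorem5p8 R D D̃ tA tA-iso tC tC-iso =
  tB , (t-isGroupHomomorphism , θ-isGroupHomomorphism) , (λ tB′ _ → tB-unique tB′) ,
  tB-isModuleIsomorphism , θ-isGroupIsomorphism , θ-isRLinear
  where open Isomorphism D D̃ tA tA-iso tC tC-iso
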